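{- For all types $\sigma,\tau,\rho$ the following strong isomorphisms hold: $\sigma\wedge\sigma\approx_{\mathsf s}\sigma$; $\sigma\vee\sigma\approx_{\mathsf s}\sigma$; $\sigma\wedge\tau\approx_{\mathsf s}\tau\wedge\sigma$; $\sigma\vee\tau\approx_{\mathsf s}\tau\vee\sigma$; $(\sigma\wedge\tau)\wedge\rho\approx_{\mathsf s}\sigma\wedge(\tau\wedge\rho)$; $(\sigma\vee\tau)\vee\rho\approx_{\mathsf s}\sigma\vee(\tau\vee\rho)$; $(\sigma\vee\tau)\wedge\rho\approx_{\mathsf s}(\sigma\wedge\rho)\vee(\tau\wedge\rho)$; $(\sigma\wedge\tau)\vee\rho\approx_{\mathsf s}(\sigma\vee\rho)\wedge(\tau\vee\rho)$; $\sigma\to\tau\wedge\rho\approx_{\mathsf s}(\sigma\to\tau)\wedge(\sigma\to\rho)$; $\sigma\vee\tau\to\rho\approx_{\mathsf s}(\sigma\to\rho)\wedge(\tau\to\rho)$.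
   Context: Types: $\sigma ::= \varphi \mid \omega \mid \sigma\to\sigma \mid \sigma\wedge\sigma \mid \sigma\vee\sigma$, $\varphi$ ranging over a denumerable set of atomic types, $\omega$ a further constant; $\wedge,\vee$ bind tighter than $\to$. Semantic equivalence $\simeq$ is the least congruence with $\varphi\simeq\omega\to\varphi$, $\omega\simeq\omega\to\omega$, $\sigma\simeq\sigma\wedge\omega$, $\sigma\simeq\omega\wedge\sigma$, $\omega\simeq\sigma\vee\omega$, $\omega\simeq\omega\vee\sigma$ (no other identifications, e.g. $\sigma\wedge\tau$ and $\tau\wedge\sigma$ are distinct types). Types are assigned to linear $\lambda$-terms (each free or bound variable occurs exactly once); environments are finite maps from variables to types, $\Gamma_1,\Gamma_2$ denotes union with disjoint domains. Rules: (Ax) $x:\sigma\vdash x:\sigma$; ($\simeq$) from $\Gamma\vdash M:\sigma$, $\sigma\simeq\tau$ infer $\Gamma\vdash M:\tau$; ($\to I$) from $\Gamma,x:\sigma\vdash M:\tau$ infer $\Gamma\vdash\lambda x.M:\sigma\to\tau$; ($\to E$) from $\Gamma_1\vdash M:\sigma\to\tau$, $\Gamma_2\vdash N:\sigma$ infer $\Gamma_1,\Gamma_2\vdash MN:\tau$; ($\wedge I$) from $\Gamma\vdash M:\sigma$, $\Gamma\vdash M:\tau$ infer $\Gamma\vdash M:\sigma\wedge\tau$; ($\wedge E$) from $\Gamma\vdash M:\sigma\wedge\tau$ infer $\Gamma\vdash M:\sigma$ and $\Gamma\vdash M:\tau$; ($\vee I$) from $\Gamma\vdash M:\sigma$ infer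 $\Gamma\vdash M:\sigma\vee\tau$ and $\Gamma\vdash M:\tau\vee\sigma$; ($\vee E$) from $\Gamma_1,x:\sigma\wedge\zeta\vdash M:\rho$, $\Gamma_1,x:\tau\wedge\zeta\vdash M:\rho$, $\Gamma_2\vdash N:(\sigma\vee\tau)\wedge\zeta$ infer $\Gamma_1,\Gamma_2\vdash M[N/x]:\rho$. A finite hereditary identity (FHI) is a $\lambda$-term $\beta$-convertible to $\lambda xy_1\ldots y_n.x(\mathsf{Id}_1y_1)\ldots(\mathsf{Id}_ny_n)$ ($n\ge0$) with $\mathsf{Id}_1,\ldots,\mathsf{Id}_n$ FHIs. $\sigma\approx_{\mathsf s}\tau$ (strongly isomorphic) if there is an FHI $\mathsf{Id}$ with $\vdash\mathsf{Id}:\sigma\to\tau$ and $\vdash\mathsf{Id}:\tau\to\sigma$. -}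

module Defs where

open import Data.Nat using (ℕ; zero; suc; _+_)
open import Data.Fin using (Fin; zero; suc; _↑ˡ_; _↑ʳ_; opposite)
open import Data.Maybe using (Maybe; just; nothing)
open import Data.Vec using (Vec; []; _∷_; replicate; _[_]≔_)
open import Data.Product using (Σ; _×_)
open import Relation.Binary.Construct.Closure.Equivalence using (EqClosure)

infixr 5 _⇒_
infixr 7 _∧_ _∨_

data Ty : Set where
  atom : ℕ → Ty
  ω    : Ty
  _⇒_  : Ty → Ty → Ty
  _∧_  : Ty → Ty → Ty
  _∨_  : Ty → Ty → Ty

infix 4 _≃_
data _≃_ : Ty → Ty → Set where
  ≃-refl  : ∀ {σ} → σ ≃ σ
  ≃-sym   : ∀ {σ τ} → σ ≃ τ → τ ≃ σ
  ≃-trans : ∀ {σ τ ρ} → σ ≃ τ → τ ≃ ρ → σ ≃ ρ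
  ≃-⇒     : ∀ {σ σ' τ τ'} → σ ≃ σ' → τ ≃ τ' → (σ ⇒ τ) ≃ (σ' ⇒ τ')
  ≃-∧     : ∀ {σ σ' τ τ'} → σ ≃ σ' → τ ≃ τ' → (σ ∧ τ) ≃ (σ' ∧ τ')
  ≃-∨     : ∀ {σ σ' τ τ'} → σ ≃ σ' → τ ≃ τ' → (σ ∨ τ) ≃ (σ' ∨ τ')
  ax-atom : ∀ {n} → atom n ≃ (ω ⇒ atom n)
  ax-ωω   : ω ≃ (ω ⇒ ω)
  ax-∧ʳ   : ∀ {σ} → σ ≃ (σ ∧ ω)
  ax-∧ˡ   : ∀ {σ} → σ ≃ (ω ∧ σ)
  ax-∨ʳ   : ∀ {σ} → ω ≃ (σ ∨ ω)
  ax-∨ˡ   : ∀ {σ} → ω ≃ (ω ∨ σ)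

data Tm (n : ℕ) : Set where
  var : Fin n → Tm n
  lam : Tm (suc n) → Tm n
  app : Tm n → Tm n → Tm n

Ren : ℕ → ℕ → Set
Ren m n = Fin m → Fin n

ext : ∀ {m n} → Ren m n → Ren (suc m) (suc n)
ext ρ zero    = zero
ext ρ (suc i) = suc (ρ i)

rename : ∀ {m n} → Ren m n → Tm m → Tm n
rename ρ (var i)   = var (ρ i)
rename ρ (lam M)   = lam (rename (ext ρ) M)
rename ρ (app M N) = app (rename ρ M) (rename ρ N)

Sub : ℕ → ℕ → Set
Sub m n = Fin m → Tm n

exts : ∀ {m n} → Sub m n → Sub (suc m) (suc n)
exts s zero    = var zero
exts s (suc i) = rename suc (s i)

subst : ∀ {m n} → Sub m n → Tm m → Tm n
subst s (var i)   = s i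
subst s (lam M)   = lam (subst (exts s) M)
subst s (app M N) = app (subst s M) (subst s N)

single : ∀ {n} → Tm n → Sub (suc n) n
single N zero    = N
single N (suc i) = var i

_[_]₀ : ∀ {n} → Tm (suc n) → Tm n → Tm n
M [ N ]₀ = subst (single N) M

infix 4 _→β_ _=β_
data _→β_ {n} : Tm n → Tm n → Set where
  β     : ∀ {M N} → app (lam M) N →β M [ N ]₀
  ξ-lam : ∀ {M M'} → M →β M' → lam M →β lam M'
  ξ-appˡ : ∀ {M M' N} → M →β M' → app M N →β app M' N
  ξ-appʳ : ∀ {M N N'} → N →β N' → app M N →β app M N'

_=β_ : ∀ {n} → Tm n → Tm n → Set
_=β_ = EqClosure _→β_

lams : ∀ {m} (k : ℕ) → Tm (k + m) → Tm m
lams zero    t = t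
lams (suc k) t = lams k (lam t)

spine : ∀ {m k} → Tm m → (Fin k → Tm m) → Tm m
spine {k = zero}  h as = h
spine {k = suc k} h as = spine (app h (as zero)) (λ i → as (suc i))

-- λ x y₁ … y_k . x (Id₁ y₁) … (Id_k y_k)
-- inside the body, x is index k and y_{i+1} is index k-1-i
fhiShape : ∀ {n} (k : ℕ) → (Fin k → Tm n) → Tm n
fhiShape {n} k ids =
  lam (lams k (spine (var (k ↑ʳ (zero {n})))
                     (λ i → app (rename (λ j → k ↑ʳ suc j) (ids i))
                                (var (opposite i ↑ˡ suc n)))))

data FHI {n} : Tm n → Set where
  fhi : ∀ {M} (k : ℕ) (ids : Fin k → Tm n) →
        ((i : Fin k) → FHI (ids i)) → M =β fhiShape k ids → FHI M

-- an environment over n de Bruijn positions: position i is in the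
-- domain iff it holds (just σ)
Ctx : ℕ → Set
Ctx n = Vec (Maybe Ty) n

data Split : ∀ {n} → Ctx n → Ctx n → Ctx n → Set where
  []   : Split [] [] []
  none : ∀ {n} {Γ Γ₁ Γ₂ : Ctx n} → Split Γ Γ₁ Γ₂ →
         Split (nothing ∷ Γ) (nothing ∷ Γ₁) (nothing ∷ Γ₂)
  left : ∀ {n σ} {Γ Γ₁ Γ₂ : Ctx n} → Split Γ Γ₁ Γ₂ →
         Split (just σ ∷ Γ) (just σ ∷ Γ₁) (nothing ∷ Γ₂)
  right : ∀ {n σ} {Γ Γ₁ Γ₂ : Ctx n} → Split Γ Γ₁ Γ₂ →
         Split (just σ ∷ Γ) (nothing ∷ Γ₁) (just σ ∷ Γ₂)

[_∶_] : ∀ {n} → Fin n → Ty → Ctx n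
[ x ∶ σ ] = replicate _ nothing [ x ]≔ just σ

infix 3 _⊢_∶_
data _⊢_∶_ : ∀ {n} → Ctx n → Tm n → Ty → Set where
  Ax  : ∀ {n} (x : Fin n) {σ} → [ x ∶ σ ] ⊢ var x ∶ σ
  Eq  : ∀ {n} {Γ : Ctx n} {M σ τ} → Γ ⊢ M ∶ σ → σ ≃ τ → Γ ⊢ M ∶ τ
  ⇒I  : ∀ {n} {Γ : Ctx n} {M σ τ} → (just σ ∷ Γ) ⊢ M ∶ τ → Γ ⊢ lam M ∶ σ ⇒ τ
  ⇒E  : ∀ {n} {Γ Γ₁ Γ₂ : Ctx n} {M N σ τ} → Split Γ Γ₁ Γ₂ →
        Γ₁ ⊢ M ∶ σ ⇒ τ → Γ₂ ⊢ N ∶ σ → Γ ⊢ app M N ∶ τ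
  ∧I  : ∀ {n} {Γ : Ctx n} {M σ τ} → Γ ⊢ M ∶ σ → Γ ⊢ M ∶ τ → Γ ⊢ M ∶ σ ∧ τ
  ∧Eˡ : ∀ {n} {Γ : Ctx n} {M σ τ} → Γ ⊢ M ∶ σ ∧ τ → Γ ⊢ M ∶ σ
  ∧Eʳ : ∀ {n} {Γ : Ctx n} {M σ τ} → Γ ⊢ M ∶ σ ∧ τ → Γ ⊢ M ∶ τ
  ∨Iˡ : ∀ {n} {Γ : Ctx n} {M σ τ} → Γ ⊢ M ∶ σ → Γ ⊢ M ∶ σ ∨ τ
  ∨Iʳ : ∀ {n} {Γ : Ctx n} {M σ τ} → Γ ⊢ M ∶ σ → Γ ⊢ M ∶ τ ∨ σ
  ∨E  : ∀ {n} {Γ Γ₁ Γ₂ : Ctx n} {M : Tm (suc n)} {N σ τ ζ ρ} →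
        Split Γ Γ₁ Γ₂ →
        (just (σ ∧ ζ) ∷ Γ₁) ⊢ M ∶ ρ →
        (just (τ ∧ ζ) ∷ Γ₁) ⊢ M ∶ ρ →
        Γ₂ ⊢ N ∶ (σ ∨ τ) ∧ ζ →
        Γ ⊢ M [ N ]₀ ∶ ρ

infix 2 _≈s_
_≈s_ : Ty → Ty → Set
σ ≈s τ = Σ (Tm 0) λ Id → FHI Id × ([] ⊢ Id ∶ σ ⇒ τ) × ([] ⊢ Id ∶ τ ⇒ σ)

-- Write A ⊑ B when every derivation Γ ⊢ M ∶ A can be turned into one of
-- Γ ⊢ M ∶ B.  The rules for ∧ and ∨ make ⊑ a preorder in which ∧ and ∨
-- behave like lattice meet and join and ∧ distributes over ∨ (∨E applied to
-- the body x is exactly case analysis on a type), so every non-arrow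
-- isomorphism is witnessed by the identity λx.x.  The rules cannot act under
-- an arrow, so the two arrow isomorphisms are witnessed by the η-expanded
-- identity λxy.xy instead, which β-converts to the finite hereditary
-- identity λxy.x((λz.z)y).

module Submission where

open import Defs
open import Data.Product using (_×_; _,_)
open import Data.Fin using (zero; suc)
open import Data.Maybe using (just; nothing)
open import Data.Vec using ([]; _∷_; replicate)
open import Function using (id; _∘_)
open import Relation.Binary.Construct.Closure.ReflexiveTransitive using (ε; _◅_)
open import Relation.Binary.Construct.Closure.Symmetric using (bwd)

infix 4 _⊑_

_⊑_ : Ty → Ty → Set
A ⊑ B = ∀ {n} {Γ : Ctx n} {M : Tm n} → Γ ⊢ M ∶ A → Γ ⊢ M ∶ B

≃⇒⊑ : ∀ {A B} → A ≃ B → A ⊑ B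
≃⇒⊑ A≃B d = Eq d A≃B

∧-greatest : ∀ {A B C} → A ⊑ B → A ⊑ C → A ⊑ B ∧ C
∧-greatest f g d = ∧I (f d) (g d)

∧-swap : ∀ {A B} → A ∧ B ⊑ B ∧ A
∧-swap = ∧-greatest ∧Eʳ ∧Eˡ

split-emptyˡ : ∀ {n} (Γ : Ctx n) → Split Γ (replicate n nothing) Γ
split-emptyˡ []            = []
split-emptyˡ (nothing ∷ Γ) = none (split-emptyˡ Γ)
split-emptyˡ (just _ ∷ Γ)  = right (split-emptyˡ Γ)

∨-elim : ∀ {A B C D} → A ∧ C ⊑ D → B ∧ C ⊑ D → (A ∨ B) ∧ C ⊑ D
∨-elim f g {Γ = Γ} d =
  ∨E {M = var zero} (split-emptyˡ Γ) (f (Ax zero)) (g (Ax zero)) d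

∨-least : ∀ {A B C} → A ⊑ C → B ⊑ C → A ∨ B ⊑ C
∨-least f g = ∨-elim (f ∘ ∧Eˡ) (g ∘ ∧Eˡ) ∘ ≃⇒⊑ ax-∧ʳ

∨-swap : ∀ {A B} → A ∨ B ⊑ B ∨ A
∨-swap = ∨-least ∨Iʳ ∨Iˡ

∧-distribʳ-∨ : ∀ {A B C} → (A ∨ B) ∧ C ⊑ (A ∧ C) ∨ (B ∧ C)
∧-distribʳ-∨ = ∨-elim ∨Iˡ ∨Iʳ

∨-distribʳ-∧ : ∀ {A B C} → (A ∨ C) ∧ (B ∨ C) ⊑ (A ∧ B) ∨ C
∨-distribʳ-∧ = ∨-elim (∨-elim (∨Iˡ ∘ ∧-swap) (∨Iʳ ∘ ∧Eˡ) ∘ ∧-swap) (∨Iʳ ∘ ∧Eˡ)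

idTm : Tm 0
idTm = lam (var zero)

FHI-idTm : FHI idTm
FHI-idTm = fhi 0 (λ ()) (λ ()) ε

⊑⇒≈s : ∀ {A B} → A ⊑ B → B ⊑ A → A ≈s B
⊑⇒≈s f g = idTm , FHI-idTm , ⇒I (f (Ax zero)) , ⇒I (g (Ax zero))

ηTm : Tm 0
ηTm = lam (lam (app (var (suc zero)) (var zero)))

FHI-ηTm : FHI ηTm
FHI-ηTm = fhi 1 (λ _ → idTm) (λ _ → FHI-idTm) (bwd (ξ-lam (ξ-lam (ξ-appʳ β))) ◅ ε)

-- Body of ηTm: y is variable 0 and x is variable 1.
η-body : ∀ {F A B C} → F ⊑ A ⇒ B → C ⊑ A →
         just C ∷ just F ∷ [] ⊢ app (var (suc zero)) (var zero) ∶ B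
η-body f g = ⇒E (right (left [])) (f (Ax (suc zero))) (g (Ax zero))

η-body-∨ : ∀ {F A B C} → F ⊑ A ⇒ C → F ⊑ B ⇒ C →
           just (A ∨ B) ∷ just F ∷ [] ⊢ app (var (suc zero)) (var zero) ∶ C
η-body-∨ f g =
  ∨E {M = app (var (suc (suc zero))) (var zero)} (right (left []))
     (branch f) (branch g) (Eq (Ax zero) ax-∧ʳ)
  where
  branch : ∀ {F A C D} → F ⊑ A ⇒ C →
           just (A ∧ D) ∷ nothing ∷ just F ∷ [] ⊢ app (var (suc (suc zero))) (var zero) ∶ C
  branch h = ⇒E (right (none (left []))) (h (Ax (suc (suc zero)))) (∧Eˡ (Ax zero))

⇒-distribˡ-∧ : ∀ {A B C} → A ⇒ B ∧ C ≈s (A ⇒ B) ∧ (A ⇒ C)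
⇒-distribˡ-∧ =
  ηTm , FHI-ηTm ,
  ⇒I (∧I (⇒I (∧Eˡ (η-body id id))) (⇒I (∧Eʳ (η-body id id)))) ,
  ⇒I (⇒I (∧I (η-body ∧Eˡ id) (η-body ∧Eʳ id)))

⇒-distribʳ-∨ : ∀ {A B C} → A ∨ B ⇒ C ≈s (A ⇒ C) ∧ (B ⇒ C)
⇒-distribʳ-∨ =
  ηTm , FHI-ηTm ,
  ⇒I (∧I (⇒I (η-body id ∨Iˡ)) (⇒I (η-body id ∨Iʳ))) ,
  ⇒I (⇒I (η-body-∨ ∧Eˡ ∧Eʳ))

lemma3p6 : (σ τ ρ : Ty) →
    (σ ∧ σ ≈s σ) ×
    (σ ∨ σ ≈s σ) ×
    (σ ∧ τ ≈s τ ∧ σ) ×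
    (σ ∨ τ ≈s τ ∨ σ) ×
    ((σ ∧ τ) ∧ ρ ≈s σ ∧ (τ ∧ ρ)) ×
    ((σ ∨ τ) ∨ ρ ≈s σ ∨ (τ ∨ ρ)) ×
    ((σ ∨ τ) ∧ ρ ≈s (σ ∧ ρ) ∨ (τ ∧ ρ)) ×
    ((σ ∧ τ) ∨ ρ ≈s (σ ∨ ρ) ∧ (τ ∨ ρ)) ×
    (σ ⇒ (τ ∧ ρ) ≈s (σ ⇒ τ) ∧ (σ ⇒ ρ)) ×
    ((σ ∨ τ) ⇒ ρ ≈s (σ ⇒ ρ) ∧ (τ ⇒ ρ))
lemma3p6 σ τ ρ =
  ⊑⇒≈s ∧Eˡ (∧-greatest id id) ,
  ⊑⇒≈s (∨-least id id) ∨Iˡ ,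
  ⊑⇒≈s ∧-swap ∧-swap ,
  ⊑⇒≈s ∨-swap ∨-swap ,
  ⊑⇒≈s (∧-greatest (∧Eˡ ∘ ∧Eˡ) (∧-greatest (∧Eʳ ∘ ∧Eˡ) ∧Eʳ))
       (∧-greatest (∧-greatest ∧Eˡ (∧Eˡ ∘ ∧Eʳ)) (∧Eʳ ∘ ∧Eʳ)) ,
  ⊑⇒≈s (∨-least (∨-least ∨Iˡ (∨Iʳ ∘ ∨Iˡ)) (∨Iʳ ∘ ∨Iʳ))
       (∨-least (∨Iˡ ∘ ∨Iˡ) (∨-least (∨Iˡ ∘ ∨Iʳ) ∨Iʳ)) ,
  ⊑⇒≈s ∧-distribʳ-∨ (∨-least (∧-greatest (∨Iˡ ∘ ∧Eˡ) ∧Eʳ) (∧-greatest (∨Iʳ ∘ ∧Eˡ) ∧Eʳ)) ,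
  ⊑⇒≈s (∨-least (∧-greatest (∨Iˡ ∘ ∧Eˡ) (∨Iˡ ∘ ∧Eʳ)) (∧-greatest ∨Iʳ ∨Iʳ)) ∨-distribʳ-∧ ,
  ⇒-distribˡ-∧ ,
  ⇒-distribʳ-∨
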